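{- Let $h$ and $n$ be integers with $0<h<n/2$. If $h$ is even, then \[ \mathcal{N}_n(2h)=\mathcal{N}_n(h)-\varphi(h). \] If $h$ is odd, then \[ \mathcal{N}_n(2h)=\frac{1}{2}\left(\mathcal{N}_n(h)-\varphi(h)-\delta_{1h}+\sum_{d\mid h}\mu(d)\,w(n/d)\right), \] where $w(x)=\lfloor x\rfloor \bmod 2$.
   Context: For a positive integer $n$, the Farey sequence $F_n$ is the set of irreducible fractions $a/b$ with $0<a/b\leq 1$ and $1\leq b\leq n$ (the fraction $0/1$ is excluded, $1/1$ is included). $\mathcal{N}_n(h)$ denotes the number of fractions in $F_n$ whose (reduced) numerator equals $h$. $\varphi$ is Euler's totient function, $\mu$ the Möbius function, and $\delta_{1h}$ the Kronecker delta (equal to $1$ if $h=1$, else $0$). -}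

module Defs where

open import Data.Nat as ℕ using (ℕ; zero; suc; _*_; _≤_; _≤?_; _/_; _%_)
open import Data.Nat.Divisibility using (_∣_; _∣?_)
open import Data.Nat.Coprimality using (Coprime; coprime?)
open import Data.Nat.Primality using (Prime; prime?)
open import Data.Integer as ℤ using (ℤ; +_)
open import Data.List.Relation.Unary.Any using (any?)
open import Data.List using (List; []; _∷_; length; filter; map; concatMap; applyUpTo; foldr)
open import Data.Product using (_×_; _,_; proj₁; proj₂)
open import Data.Bool using (if_then_else_)
open import Relation.Nullary using (does)
open import Relation.Nullary.Decidable using (_×-dec_)

oneTo : ℕ → List ℕ
oneTo n = applyUpTo suc n

-- The Farey sequence F_n as a list of (numerator , denominator) pairs:
-- irreducible a/b with 0 < a/b ≤ 1 and 1 ≤ b ≤ n, i.e. 1 ≤ a ≤ b ≤ n, gcd a b = 1.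
farey : ℕ → List (ℕ × ℕ)
farey n = concatMap (λ b → map (λ a → (a , b)) (filter (λ a → coprime? a b) (oneTo b))) (oneTo n)

𝒩 : ℕ → ℕ → ℕ
𝒩 n h = length (filter (λ p → proj₁ p ℕ.≟ h) (farey n))

φ : ℕ → ℕ
φ m = length (filter (λ k → coprime? k m) (oneTo m))

-- Möbius function: 0 if d is divisible by k² for some k ≥ 2,
-- otherwise (-1)^(number of distinct prime divisors of d).  μ(0) := 0 (never used).
μ : ℕ → ℤ
μ zero = + 0
μ d@(suc _) =
  if does (any? (λ k → (2 ≤? k) ×-dec ((k * k) ∣? d)) (oneTo d))
  then + 0
  else (if does (primeCount % 2 ℕ.≟ 0) then + 1 else ℤ.- (+ 1))
  where
  primeCount : ℕ
  primeCount = length (filter (λ p → prime? p ×-dec (p ∣? d)) (oneTo d))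

δ₁ : ℕ → ℤ
δ₁ h = if does (h ℕ.≟ 1) then + 1 else + 0

-- w(x) = ⌊x⌋ mod 2, applied to x = n/d (d ≥ 1), so ⌊n/d⌋ is natural-number division.
w : (n d : ℕ) → .{{ℕ.NonZero d}} → ℕ
w n d = (n / d) % 2

divisorSum : ℕ → ℕ → ℤ
divisorSum n h = foldr ℤ._+_ (+ 0) (map term (oneTo h))
  where
  term : ℕ → ℤ
  term zero = + 0
  term d@(suc _) = if does (d ∣? h) then μ d ℤ.* (+ w n d) else + 0

-- Write Φ h x for the number of 1 ≤ b ≤ x coprime to h. Counting the Farey fractions with
-- numerator m by their denominators b ∈ [m, n] gives 𝒩_n(m) = Φ m n - Φ m (m - 1), and since
-- coprimality to h has period h, Φ h (2h - 1) = Φ h (h - 1) + φ(h).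
-- An integer is coprime to 2h iff it is odd and coprime to h (for even h the second condition
-- implies the first), which settles the even case and for odd h gives 2 Φ (2h) x = Φ h x + Φ± h x,
-- where Φ± h x = Σ_{b ≤ x, (b,h) = 1} (-1)^(b+1). For odd h this sign flips under b ↦ b + h, so
-- Φ± h (2h - 1) = δ_{1h}. Finally Φ± h n = Σ_{d ∣ h} μ(d) w(n/d) by induction on n: ⌊n/d⌋ mod 2
-- changes from n to n + 1 exactly when d ∣ n + 1, and then by (-1)^n if d is odd, while
-- Σ_{d ∣ gcd(h, n+1)} μ(d) = [gcd(h, n+1) = 1].

module Submission where

open import Data.Bool using (if_then_else_)
open import Data.Empty using (⊥; ⊥-elim)
open import Data.Integer as ℤ using (ℤ; +_; _+_; _-_; -_)
import Data.Integer.Properties as ℤₚ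
open import Data.Integer.Tactic.RingSolver using (solve-∀)
open import Data.List using (List; []; _∷_; _++_; length; filter; map; concatMap; foldr; applyUpTo)
import Data.List.Properties as Listₚ
open import Data.List.Membership.Propositional using (find; lose)
open import Data.List.Membership.Propositional.Properties using (∈-applyUpTo⁺)
open import Data.List.Relation.Unary.Any using (Any; any?)
open import Data.Nat as ℕ using (ℕ; zero; suc; _*_; _≤_; _<_; z≤n; s≤s; _≤?_)
import Data.Nat.Properties as ℕₚ
open import Data.Nat.Coprimality using (Coprime; coprime?; coprime-divisor; gcd≡1⇒coprime; coprime⇒gcd≡1)
import Data.Nat.Coprimality as Coprime
open import Data.Nat.Divisibility
  using ( _∣_; _∣?_; divides; _∣0; ∣-refl; ∣-trans; ∣⇒≤; ∣1⇒≡1; ∣m∣n⇒∣m+n; ∣m+n∣m⇒∣n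
        ; m∣m*n; n∣m*n; ∣m⇒∣m*n; ∣n⇒∣m*n; *-pres-∣; *-monoˡ-∣; *-cancelʳ-∣
        ; m%n≡0⇒n∣m; n∣m⇒m%n≡0; hasNonTrivialDivisor)
open import Data.Nat.DivMod
  using ( _%_; _/_; %-distribˡ-+; m%n<n; [m+n]%n≡m%n; m≡m%n+[m/n]*n
        ; /-congˡ; +-distrib-/-∣ʳ; m<n⇒m/n≡0; m*n/n≡m; m/n*n≡m)
open import Data.Nat.GCD using (gcd; gcd[m,n]∣m; gcd[m,n]∣n; gcd-greatest; gcd[m,n]≢0)
open import Data.Nat.Induction using (<-rec)
open import Data.Nat.Primality
  using (Prime; prime?; prime[2]; prime⇒irreducible; prime⇒nonZero; prime⇒nonTrivial; ¬prime⇒composite; euclidsLemma)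
open import Data.Product using (_×_; _,_; proj₁; ∃-syntax)
open import Data.Sum using (_⊎_; inj₁; inj₂)
open import Function using (_∘_)
open import Level using (0ℓ)
open import Relation.Binary.PropositionalEquality
open import Relation.Nullary using (Dec; yes; no; ¬_; does)
open import Relation.Nullary.Decidable using (_×-dec_; ¬?; map′)
open import Relation.Unary using (Pred; Decidable)
open import Algebra.Properties.AbelianGroup ℤₚ.+-0-abelianGroup using (∙-cancelˡ)

open import Defs

𝟙 : {P : Set} → Dec P → ℤ
𝟙 P? = if does P? then + 1 else + 0

𝟙-yes : {P : Set} (P? : Dec P) → P → 𝟙 P? ≡ + 1
𝟙-yes (yes _) _ = refl
𝟙-yes (no ¬p) p = ⊥-elim (¬p p)

𝟙-no : {P : Set} (P? : Dec P) → ¬ P → 𝟙 P? ≡ + 0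
𝟙-no (yes p) ¬p = ⊥-elim (¬p p)
𝟙-no (no _) _ = refl

𝟙-⇔ : {P Q : Set} (P? : Dec P) (Q? : Dec Q) → (P → Q) → (Q → P) → 𝟙 P? ≡ 𝟙 Q?
𝟙-⇔ (yes p) Q? f g = sym (𝟙-yes Q? (f p))
𝟙-⇔ (no ¬p) Q? f g = sym (𝟙-no Q? (¬p ∘ g))

𝟙-× : {P Q : Set} (P? : Dec P) (Q? : Dec Q) → 𝟙 (P? ×-dec Q?) ≡ 𝟙 P? ℤ.* 𝟙 Q?
𝟙-× (yes _) (yes _) = refl
𝟙-× (yes _) (no _) = refl
𝟙-× (no _) _ = refl

𝟙-¬ : {P : Set} (P? : Dec P) → 𝟙 (¬? P?) ≡ + 1 - 𝟙 P?
𝟙-¬ (yes _) = refl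
𝟙-¬ (no _) = refl

𝟙-⊎ : {P Q R : Set} (P? : Dec P) (Q? : Dec Q) (R? : Dec R) →
      (P → Q ⊎ R) → (Q → P) → (R → P) → (Q → R → ⊥) → 𝟙 P? ≡ 𝟙 Q? + 𝟙 R?
𝟙-⊎ (no ¬p) Q? R? f g h _ = sym (cong₂ _+_ (𝟙-no Q? (¬p ∘ g)) (𝟙-no R? (¬p ∘ h)))
𝟙-⊎ (yes p) Q? R? f g h disj with f p
... | inj₁ q = sym (cong₂ _+_ (𝟙-yes Q? q) (𝟙-no R? (disj q)))
... | inj₂ r = sym (cong₂ _+_ (𝟙-no Q? (λ q → disj q r)) (𝟙-yes R? r))

if-then-0≡𝟙* : {P : Set} (P? : Dec P) (x : ℤ) → (if does P? then x else + 0) ≡ 𝟙 P? ℤ.* x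
if-then-0≡𝟙* (yes _) x = sym (ℤₚ.*-identityˡ x)
if-then-0≡𝟙* (no _) x = refl

𝟙-split : {P : Set} (P? : Dec P) (x : ℤ) → x ≡ 𝟙 P? ℤ.* x + 𝟙 (¬? P?) ℤ.* x
𝟙-split (yes _) = solve-∀
𝟙-split (no _) = solve-∀

∑ : ℕ → (ℕ → ℤ) → ℤ
∑ zero f = + 0
∑ (suc N) f = ∑ N f + f (suc N)

module _ {f g : ℕ → ℤ} where

  ∑-cong : ∀ N → (∀ k → 1 ≤ k → k ≤ N → f k ≡ g k) → ∑ N f ≡ ∑ N g
  ∑-cong zero _ = refl
  ∑-cong (suc N) f≡g =
    cong₂ _+_ (∑-cong N (λ k 1≤k k≤N → f≡g k 1≤k (ℕₚ.m≤n⇒m≤1+n k≤N)))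
              (f≡g (suc N) (s≤s z≤n) ℕₚ.≤-refl)

  ∑-distrib-+ : ∀ N → ∑ N (λ k → f k + g k) ≡ ∑ N f + ∑ N g
  ∑-distrib-+ zero = refl
  ∑-distrib-+ (suc N) = trans (cong (_+ (f (suc N) + g (suc N))) (∑-distrib-+ N))
                              (interchange (∑ N f) (∑ N g) (f (suc N)) (g (suc N)))
    where
    interchange : ∀ a b c d → (a + b) + (c + d) ≡ (a + c) + (b + d)
    interchange = solve-∀

∑-zero : ∀ N {f : ℕ → ℤ} → (∀ k → 1 ≤ k → k ≤ N → f k ≡ + 0) → ∑ N f ≡ + 0
∑-zero zero _ = refl
∑-zero (suc N) f≡0 = cong₂ _+_ (∑-zero N (λ k 1≤k k≤N → f≡0 k 1≤k (ℕₚ.m≤n⇒m≤1+n k≤N)))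
                               (f≡0 (suc N) (s≤s z≤n) ℕₚ.≤-refl)

∑-*ˡ : ∀ N c (f : ℕ → ℤ) → ∑ N (λ k → c ℤ.* f k) ≡ c ℤ.* ∑ N f
∑-*ˡ zero c f = sym (ℤₚ.*-zeroʳ c)
∑-*ˡ (suc N) c f = trans (cong (_+ c ℤ.* f (suc N)) (∑-*ˡ N c f)) (sym (ℤₚ.*-distribˡ-+ c _ _))

∑-neg : ∀ N (f : ℕ → ℤ) → ∑ N (λ k → - f k) ≡ - ∑ N f
∑-neg zero f = refl
∑-neg (suc N) f = trans (cong (_+ - f (suc N)) (∑-neg N f)) (sym (ℤₚ.neg-distrib-+ (∑ N f) _))

∑-front : ∀ N (f : ℕ → ℤ) → ∑ (suc N) f ≡ f 1 + ∑ N (f ∘ suc)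
∑-front zero f = trans (ℤₚ.+-identityˡ (f 1)) (sym (ℤₚ.+-identityʳ (f 1)))
∑-front (suc N) f = trans (cong (_+ f (suc (suc N))) (∑-front N f)) (ℤₚ.+-assoc (f 1) _ _)

∑-split : ∀ M N (f : ℕ → ℤ) → ∑ (M ℕ.+ N) f ≡ ∑ M f + ∑ N (λ k → f (M ℕ.+ k))
∑-split M zero f = trans (cong (λ x → ∑ x f) (ℕₚ.+-identityʳ M)) (sym (ℤₚ.+-identityʳ _))
∑-split M (suc N) f = begin
  ∑ (M ℕ.+ suc N) f                              ≡⟨ cong (λ x → ∑ x f) (ℕₚ.+-suc M N) ⟩
  ∑ (M ℕ.+ N) f + f (suc (M ℕ.+ N))              ≡⟨ cong₂ _+_ (∑-split M N f) (cong f (sym (ℕₚ.+-suc M N))) ⟩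
  ∑ M f + ∑ N (λ k → f (M ℕ.+ k)) + f (M ℕ.+ suc N) ≡⟨ ℤₚ.+-assoc (∑ M f) _ _ ⟩
  ∑ M f + ∑ (suc N) (λ k → f (M ℕ.+ k))          ∎
  where open ≡-Reasoning

∑-extend : ∀ {M N} (f : ℕ → ℤ) → M ≤ N → (∀ k → M < k → k ≤ N → f k ≡ + 0) → ∑ N f ≡ ∑ M f
∑-extend {M} f M≤N f≡0 with ℕₚ.m≤n⇒∃[o]m+o≡n M≤N
... | m , refl = begin
  ∑ (M ℕ.+ m) f                    ≡⟨ ∑-split M m f ⟩
  ∑ M f + ∑ m (λ k → f (M ℕ.+ k))  ≡⟨ cong (_+_ (∑ M f)) (∑-zero m (λ k 1≤k k≤m → f≡0 (M ℕ.+ k)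
                                        (ℕₚ.m<m+n M 1≤k)
                                        (ℕₚ.+-monoʳ-≤ M k≤m))) ⟩
  ∑ M f + + 0                      ≡⟨ ℤₚ.+-identityʳ _ ⟩
  ∑ M f                            ∎
  where open ≡-Reasoning

∑-single : ∀ {N} j (f : ℕ → ℤ) → 1 ≤ j → j ≤ N →
           (∀ k → 1 ≤ k → k ≤ N → k ≢ j → f k ≡ + 0) → ∑ N f ≡ f j
∑-single {N} (suc i) f _ j≤N f≡0 = begin
  ∑ N f               ≡⟨ ∑-extend f j≤N (λ k j<k k≤N → f≡0 k (ℕₚ.≤-trans (s≤s z≤n) j<k) k≤N (ℕₚ.>⇒≢ j<k)) ⟩
  ∑ i f + f (suc i)   ≡⟨ cong (_+ f (suc i)) (∑-zero i (λ k 1≤k k≤i →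
                           f≡0 k 1≤k (ℕₚ.≤-trans k≤i (ℕₚ.≤-trans (ℕₚ.n≤1+n i) j≤N)) (ℕₚ.<⇒≢ (s≤s k≤i)))) ⟩
  + 0 + f (suc i)     ≡⟨ ℤₚ.+-identityˡ _ ⟩
  f (suc i)           ∎
  where open ≡-Reasoning

∑-𝟙-≟ : ∀ N j → 1 ≤ j → ∑ N (λ k → 𝟙 (k ℕ.≟ j)) ≡ 𝟙 (j ≤? N)
∑-𝟙-≟ N j 1≤j with j ≤? N
... | yes j≤N = begin
  ∑ N (λ k → 𝟙 (k ℕ.≟ j)) ≡⟨ ∑-single j _ 1≤j j≤N (λ k _ _ k≢j → 𝟙-no (k ℕ.≟ j) k≢j) ⟩
  𝟙 (j ℕ.≟ j)              ≡⟨ 𝟙-yes (j ℕ.≟ j) refl ⟩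
  + 1                      ≡⟨ 𝟙-yes (j ≤? N) j≤N ⟨
  𝟙 (j ≤? N)               ∎
  where open ≡-Reasoning
... | no j≰N = trans (∑-zero N (λ k _ k≤N → 𝟙-no (k ℕ.≟ j) (λ { refl → j≰N k≤N })))
                     (sym (𝟙-no (j ≤? N) j≰N))

∑-tail : ∀ {n} t (f : ℕ → ℤ) → t ≤ n → ∑ n (λ b → 𝟙 (suc t ≤? b) ℤ.* f b) ≡ ∑ n f - ∑ t f
∑-tail t f t≤n with ℕₚ.m≤n⇒∃[o]m+o≡n t≤n
... | m , refl = begin
  ∑ (t ℕ.+ m) g                                    ≡⟨ ∑-split t m g ⟩
  ∑ t g + ∑ m (λ k → g (t ℕ.+ k))                  ≡⟨ cong₂ _+_ (∑-zero t below) (∑-cong m above) ⟩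
  + 0 + ∑ m (λ k → f (t ℕ.+ k))                    ≡⟨ shift (∑ t f) _ ⟩
  (∑ t f + ∑ m (λ k → f (t ℕ.+ k))) - ∑ t f        ≡⟨ cong (_- ∑ t f) (∑-split t m f) ⟨
  ∑ (t ℕ.+ m) f - ∑ t f                            ∎
  where
  open ≡-Reasoning
  g : ℕ → ℤ
  g b = 𝟙 (suc t ≤? b) ℤ.* f b
  below : ∀ b → 1 ≤ b → b ≤ t → g b ≡ + 0
  below b _ b≤t = cong (ℤ._* f b) (𝟙-no (suc t ≤? b) (ℕₚ.<⇒≱ (s≤s b≤t)))
  above : ∀ k → 1 ≤ k → k ≤ m → g (t ℕ.+ k) ≡ f (t ℕ.+ k)
  above k 1≤k _ = trans (cong (ℤ._* f (t ℕ.+ k)) (𝟙-yes (suc t ≤? t ℕ.+ k) (ℕₚ.m<m+n t 1≤k)))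
                        (ℤₚ.*-identityˡ (f (t ℕ.+ k)))
  shift : ∀ a x → + 0 + x ≡ (a + x) - a
  shift = solve-∀

∑-periodic-window : ∀ {p} (f : ℕ → ℤ) → (∀ b → f (p ℕ.+ b) ≡ f b) →
                    ∀ a → ∑ p (λ k → f (a ℕ.+ k)) ≡ ∑ p f
∑-periodic-window f periodic zero = refl
∑-periodic-window {p} f periodic (suc a) = begin
  ∑ p (λ k → f (suc a ℕ.+ k))    ≡⟨ ∑-cong p (λ k _ _ → cong f (sym (ℕₚ.+-suc a k))) ⟩
  ∑ p (F ∘ suc)                  ≡⟨ ∙-cancelˡ (F 1) _ _ rotate ⟩
  ∑ p F                          ≡⟨ ∑-periodic-window f periodic a ⟩
  ∑ p f                          ∎
  where
  open ≡-Reasoning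
  F : ℕ → ℤ
  F k = f (a ℕ.+ k)
  last≡first : F (suc p) ≡ F 1
  last≡first = begin
    f (a ℕ.+ suc p)      ≡⟨ cong f (trans (ℕₚ.+-comm a (suc p)) (cong suc (ℕₚ.+-comm p a))) ⟩
    f (suc (a ℕ.+ p))    ≡⟨ cong f (cong suc (ℕₚ.+-comm a p)) ⟩
    f (suc (p ℕ.+ a))    ≡⟨ cong f (sym (ℕₚ.+-suc p a)) ⟩
    f (p ℕ.+ suc a)      ≡⟨ periodic (suc a) ⟩
    f (suc a)            ≡⟨ cong f (ℕₚ.+-comm 1 a) ⟩
    F 1                  ∎
  rotate : F 1 + ∑ p (F ∘ suc) ≡ F 1 + ∑ p F
  rotate = begin
    F 1 + ∑ p (F ∘ suc)   ≡⟨ ∑-front p F ⟨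
    ∑ p F + F (suc p)     ≡⟨ cong (_+_ (∑ p F)) last≡first ⟩
    ∑ p F + F 1           ≡⟨ ℤₚ.+-comm (∑ p F) (F 1) ⟩
    F 1 + ∑ p F           ∎

∑-antiperiodic : ∀ {p} (f : ℕ → ℤ) → (∀ b → f (p ℕ.+ b) ≡ - f b) → ∑ (p ℕ.+ p) f ≡ + 0
∑-antiperiodic {p} f antiperiodic = begin
  ∑ (p ℕ.+ p) f                      ≡⟨ ∑-split p p f ⟩
  ∑ p f + ∑ p (λ k → f (p ℕ.+ k))    ≡⟨ cong (_+_ (∑ p f)) (∑-cong p (λ k _ _ → antiperiodic k)) ⟩
  ∑ p f + ∑ p (λ k → - f k)          ≡⟨ cong (_+_ (∑ p f)) (∑-neg p f) ⟩
  ∑ p f + - ∑ p f                    ≡⟨ ℤₚ.+-inverseʳ (∑ p f) ⟩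
  + 0                                ∎
  where open ≡-Reasoning

∑-multiples : ∀ {p} q (F : ℕ → ℤ) → 1 ≤ p →
              ∑ (q * p) (λ d → 𝟙 (p ∣? d) ℤ.* F d) ≡ ∑ q (λ e → F (e * p))
∑-multiples zero F _ = refl
∑-multiples {p} (suc q) F 1≤p = begin
  ∑ (p ℕ.+ q * p) G                     ≡⟨ cong (λ x → ∑ x G) (ℕₚ.+-comm p (q * p)) ⟩
  ∑ (q * p ℕ.+ p) G                     ≡⟨ ∑-split (q * p) p G ⟩
  ∑ (q * p) G + ∑ p (λ k → G (q * p ℕ.+ k)) ≡⟨ cong₂ _+_ (∑-multiples q F 1≤p)
                                                          (∑-single p _ 1≤p ℕₚ.≤-refl off-multiple) ⟩
  ∑ q (λ e → F (e * p)) + G (q * p ℕ.+ p) ≡⟨ cong (_+_ (∑ q (λ e → F (e * p)))) next-multiple ⟩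
  ∑ (suc q) (λ e → F (e * p))           ∎
  where
  open ≡-Reasoning
  G : ℕ → ℤ
  G d = 𝟙 (p ∣? d) ℤ.* F d
  off-multiple : ∀ k → 1 ≤ k → k ≤ p → k ≢ p → G (q * p ℕ.+ k) ≡ + 0
  off-multiple k@(suc _) _ k≤p k≢p = cong (ℤ._* F (q * p ℕ.+ k)) (𝟙-no (p ∣? q * p ℕ.+ k) p∤)
    where
    p∤ : ¬ p ∣ q * p ℕ.+ k
    p∤ p∣ = k≢p (ℕₚ.≤-antisym k≤p (∣⇒≤ (∣m+n∣m⇒∣n p∣ (n∣m*n q))))
  next-multiple : G (q * p ℕ.+ p) ≡ F (suc q * p)
  next-multiple = begin
    𝟙 (p ∣? q * p ℕ.+ p) ℤ.* F (q * p ℕ.+ p) ≡⟨ cong (ℤ._* F (q * p ℕ.+ p))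
                                                    (𝟙-yes (p ∣? q * p ℕ.+ p) (∣m∣n⇒∣m+n (n∣m*n q) ∣-refl)) ⟩
    + 1 ℤ.* F (q * p ℕ.+ p)                 ≡⟨ ℤₚ.*-identityˡ _ ⟩
    F (q * p ℕ.+ p)                         ≡⟨ cong F (ℕₚ.+-comm (q * p) p) ⟩
    F (suc q * p)                           ∎

sumℤ : List ℤ → ℤ
sumℤ = foldr _+_ (+ 0)

sumℤ-oneTo : ∀ N (f : ℕ → ℤ) → sumℤ (map f (oneTo N)) ≡ ∑ N f
sumℤ-oneTo N f = trans (cong sumℤ (Listₚ.map-applyUpTo suc f N)) (sumℤ-applyUpTo N f)
  where
  sumℤ-applyUpTo : ∀ N (f : ℕ → ℤ) → sumℤ (applyUpTo (f ∘ suc) N) ≡ ∑ N f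
  sumℤ-applyUpTo zero f = refl
  sumℤ-applyUpTo (suc N) f = trans (cong (_+_ (f 1)) (sumℤ-applyUpTo N (f ∘ suc))) (sym (∑-front N f))

module _ {A : Set} {P : Pred A 0ℓ} (P? : Decidable P) where

  length-filter≡sumℤ : ∀ xs → + length (filter P? xs) ≡ sumℤ (map (λ x → 𝟙 (P? x)) xs)
  length-filter≡sumℤ [] = refl
  length-filter≡sumℤ (x ∷ xs) with P? x
  ... | yes _ = trans (ℤₚ.pos-+ 1 _) (cong (_+_ (+ 1)) (length-filter≡sumℤ xs))
  ... | no _ = trans (length-filter≡sumℤ xs) (sym (ℤₚ.+-identityˡ _))

  length-filter-filter : {Q : Pred A 0ℓ} (Q? : Decidable Q) →
    ∀ xs → length (filter P? (filter Q? xs)) ≡ length (filter (λ x → Q? x ×-dec P? x) xs)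
  length-filter-filter Q? [] = refl
  length-filter-filter Q? (x ∷ xs) with Q? x
  ... | no _ = length-filter-filter Q? xs
  ... | yes _ with P? x
  ...   | yes _ = cong suc (length-filter-filter Q? xs)
  ...   | no _ = length-filter-filter Q? xs

  length-filter-map : {B : Set} (g : B → A) → ∀ xs → length (filter P? (map g xs)) ≡ length (filter (P? ∘ g) xs)
  length-filter-map g [] = refl
  length-filter-map g (x ∷ xs) with P? (g x)
  ... | yes _ = cong suc (length-filter-map g xs)
  ... | no _ = length-filter-map g xs

  length-filter-concatMap : {B : Set} (g : B → List A) →
    ∀ xs → + length (filter P? (concatMap g xs)) ≡ sumℤ (map (λ x → + length (filter P? (g x))) xs)
  length-filter-concatMap g [] = refl
  length-filter-concatMap g (x ∷ xs) = begin
    + length (filter P? (g x ++ concatMap g xs))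
      ≡⟨ cong (+_ ∘ length) (Listₚ.filter-++ P? (g x) (concatMap g xs)) ⟩
    + length (filter P? (g x) ++ filter P? (concatMap g xs))
      ≡⟨ cong +_ (Listₚ.length-++ (filter P? (g x))) ⟩
    + (length (filter P? (g x)) ℕ.+ length (filter P? (concatMap g xs)))
      ≡⟨ ℤₚ.pos-+ (length (filter P? (g x))) _ ⟩
    + length (filter P? (g x)) + + length (filter P? (concatMap g xs))
      ≡⟨ cong (_+_ (+ length (filter P? (g x)))) (length-filter-concatMap g xs) ⟩
    sumℤ (map (λ x → + length (filter P? (g x))) (x ∷ xs)) ∎
    where open ≡-Reasoning

length-filter-oneTo : {P : Pred ℕ 0ℓ} (P? : Decidable P) →
                      ∀ N → + length (filter P? (oneTo N)) ≡ ∑ N (λ k → 𝟙 (P? k))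
length-filter-oneTo P? N = trans (length-filter≡sumℤ P? (oneTo N)) (sumℤ-oneTo N _)

𝟙⊥ : ℕ → ℕ → ℤ
𝟙⊥ h b = 𝟙 (coprime? h b)

Φ : ℕ → ℕ → ℤ
Φ h x = ∑ x (𝟙⊥ h)

numerator-count : ∀ {h} b → 1 ≤ h →
  + length (filter (λ p → proj₁ p ℕ.≟ h) (map (λ a → (a , b)) (filter (λ a → coprime? a b) (oneTo b))))
  ≡ 𝟙 (h ≤? b) ℤ.* 𝟙⊥ h b
numerator-count {h} b 1≤h = begin
  + length (filter (λ p → proj₁ p ℕ.≟ h) (map (λ a → (a , b)) (filter (λ a → coprime? a b) (oneTo b))))
    ≡⟨ cong +_ (length-filter-map (λ p → proj₁ p ℕ.≟ h) (λ a → (a , b)) (filter (λ a → coprime? a b) (oneTo b))) ⟩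
  + length (filter (ℕ._≟ h) (filter (λ a → coprime? a b) (oneTo b)))
    ≡⟨ cong +_ (length-filter-filter (ℕ._≟ h) (λ a → coprime? a b) (oneTo b)) ⟩
  + length (filter (λ a → coprime? a b ×-dec a ℕ.≟ h) (oneTo b))
    ≡⟨ length-filter-oneTo (λ a → coprime? a b ×-dec a ℕ.≟ h) b ⟩
  ∑ b (λ a → 𝟙 (coprime? a b ×-dec a ℕ.≟ h))
    ≡⟨ ∑-cong b (λ a _ _ → trans (𝟙-⇔ (coprime? a b ×-dec a ℕ.≟ h) (coprime? h b ×-dec a ℕ.≟ h) at-h at-h⁻¹)
                                        (𝟙-× (coprime? h b) (a ℕ.≟ h))) ⟩
  ∑ b (λ a → 𝟙⊥ h b ℤ.* 𝟙 (a ℕ.≟ h))   ≡⟨ ∑-*ˡ b (𝟙⊥ h b) _ ⟩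
  𝟙⊥ h b ℤ.* ∑ b (λ a → 𝟙 (a ℕ.≟ h))   ≡⟨ cong (𝟙⊥ h b ℤ.*_) (∑-𝟙-≟ b h 1≤h) ⟩
  𝟙⊥ h b ℤ.* 𝟙 (h ≤? b)                ≡⟨ ℤₚ.*-comm (𝟙⊥ h b) _ ⟩
  𝟙 (h ≤? b) ℤ.* 𝟙⊥ h b                ∎
  where
  open ≡-Reasoning
  at-h : ∀ {a} → Coprime a b × a ≡ h → Coprime h b × a ≡ h
  at-h (c , refl) = c , refl
  at-h⁻¹ : ∀ {a} → Coprime h b × a ≡ h → Coprime a b × a ≡ h
  at-h⁻¹ (c , refl) = c , refl

𝒩-as-∑ : ∀ n h → 1 ≤ h → + 𝒩 n h ≡ ∑ n (λ b → 𝟙 (h ≤? b) ℤ.* 𝟙⊥ h b)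
𝒩-as-∑ n h 1≤h = begin
  + 𝒩 n h ≡⟨ length-filter-concatMap (λ p → proj₁ p ℕ.≟ h) _ (oneTo n) ⟩
  sumℤ (map _ (oneTo n)) ≡⟨ sumℤ-oneTo n _ ⟩
  ∑ n _ ≡⟨ ∑-cong n (λ b _ _ → numerator-count b 1≤h) ⟩
  ∑ n (λ b → 𝟙 (h ≤? b) ℤ.* 𝟙⊥ h b) ∎
  where open ≡-Reasoning

𝒩-as-Φ : ∀ n t → t ≤ n → + 𝒩 n (suc t) ≡ Φ (suc t) n - Φ (suc t) t
𝒩-as-Φ n t t≤n = trans (𝒩-as-∑ n (suc t) (s≤s z≤n)) (∑-tail t (𝟙⊥ (suc t)) t≤n)

φ-as-Φ : ∀ h → + φ h ≡ Φ h h
φ-as-Φ h = trans (length-filter-oneTo (λ k → coprime? k h) h)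
                 (∑-cong h (λ k _ _ → 𝟙-⇔ (coprime? k h) (coprime? h k) Coprime.sym Coprime.sym))

𝟙⊥-periodic : ∀ h b → 𝟙⊥ h (h ℕ.+ b) ≡ 𝟙⊥ h b
𝟙⊥-periodic h b = 𝟙-⇔ (coprime? h (h ℕ.+ b)) (coprime? h b)
  (λ c → λ (i∣h , i∣b) → c (i∣h , ∣m∣n⇒∣m+n i∣h i∣b))
  (λ c → λ (i∣h , i∣h+b) → c (i∣h , ∣m+n∣m⇒∣n i∣h+b i∣h))

Φ-+-period : ∀ h x → Φ h (x ℕ.+ h) ≡ Φ h x + + φ h
Φ-+-period h x = begin
  Φ h (x ℕ.+ h)                         ≡⟨ ∑-split x h (𝟙⊥ h) ⟩
  Φ h x + ∑ h (λ k → 𝟙⊥ h (x ℕ.+ k))    ≡⟨ cong (_+_ (Φ h x))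
                                             (∑-periodic-window (𝟙⊥ h) (𝟙⊥-periodic h) x) ⟩
  Φ h x + Φ h h                         ≡⟨ cong (_+_ (Φ h x)) (φ-as-Φ h) ⟨
  Φ h x + + φ h                         ∎
  where open ≡-Reasoning

2≢1 : 2 ≢ 1
2≢1 ()

odd⇒%2≡1 : ∀ m → ¬ 2 ∣ m → m % 2 ≡ 1
odd⇒%2≡1 m 2∤m with m % 2 in eq | m%n<n m 2
... | 0 | _ = ⊥-elim (2∤m (m%n≡0⇒n∣m m 2 eq))
... | 1 | _ = refl
... | suc (suc _) | s≤s (s≤s ())

%2≡1-𝟙∣ : ∀ m → + (m % 2) ≡ + 1 - 𝟙 (2 ∣? m)
%2≡1-𝟙∣ m with 2 ∣? m
... | yes 2∣m = trans (cong +_ (n∣m⇒m%n≡0 m 2 2∣m)) (cong (λ e → + 1 - e) (sym (𝟙-yes (2 ∣? m) 2∣m)))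
... | no 2∤m = trans (cong +_ (odd⇒%2≡1 m 2∤m)) (cong (λ e → + 1 - e) (sym (𝟙-no (2 ∣? m) 2∤m)))

odd+odd : ∀ {h b} → ¬ 2 ∣ h → ¬ 2 ∣ b → 2 ∣ h ℕ.+ b
odd+odd {h} {b} 2∤h 2∤b = m%n≡0⇒n∣m (h ℕ.+ b) 2 (begin
  (h ℕ.+ b) % 2              ≡⟨ %-distribˡ-+ h b 2 ⟩
  (h % 2 ℕ.+ b % 2) % 2      ≡⟨ cong₂ (λ x y → (x ℕ.+ y) % 2) (odd⇒%2≡1 h 2∤h) (odd⇒%2≡1 b 2∤b) ⟩
  0                          ∎)
  where open ≡-Reasoning

𝟙-2∣-+odd : ∀ {h} b → ¬ 2 ∣ h → 𝟙 (2 ∣? h ℕ.+ b) ≡ + 1 - 𝟙 (2 ∣? b)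
𝟙-2∣-+odd {h} b 2∤h = trans (𝟙-⇔ (2 ∣? h ℕ.+ b) (¬? (2 ∣? b))
  (λ 2∣h+b 2∣b → 2∤h (∣m+n∣m⇒∣n (subst (2 ∣_) (ℕₚ.+-comm h b) 2∣h+b) 2∣b)) (odd+odd 2∤h))
  (𝟙-¬ (2 ∣? b))

coprime-*ˡ : ∀ {m k n} → Coprime m n → Coprime k n → Coprime (m * k) n
coprime-*ˡ {m} m⊥n k⊥n (i∣mk , i∣n) =
  k⊥n (coprime-divisor (λ (j∣i , j∣m) → m⊥n (j∣m , ∣-trans j∣i i∣n)) i∣mk , i∣n)

odd⇒coprime-2 : ∀ {b} → ¬ 2 ∣ b → Coprime 2 b
odd⇒coprime-2 2∤b (i∣2 , i∣b) with prime⇒irreducible prime[2] i∣2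
... | inj₁ i≡1 = i≡1
... | inj₂ refl = ⊥-elim (2∤b i∣b)

coprime-2*⁻ : ∀ {h b} → Coprime (2 * h) b → Coprime h b × ¬ 2 ∣ b
coprime-2*⁻ {h} 2h⊥b = (λ (i∣h , i∣b) → 2h⊥b (∣n⇒∣m*n 2 i∣h , i∣b))
                      , (λ 2∣b → 2≢1 (2h⊥b (m∣m*n h , 2∣b)))

coprime-2*⁺ : ∀ {h b} → Coprime h b → ¬ 2 ∣ b → Coprime (2 * h) b
coprime-2*⁺ h⊥b 2∤b = coprime-*ˡ (odd⇒coprime-2 2∤b) h⊥b

Φ-2*-even : ∀ {h} → 2 ∣ h → ∀ x → Φ (2 * h) x ≡ Φ h x
Φ-2*-even {h} 2∣h x = ∑-cong x (λ b _ _ → 𝟙-⇔ (coprime? (2 * h) b) (coprime? h b)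
  (proj₁ ∘ coprime-2*⁻) (λ h⊥b → coprime-2*⁺ h⊥b (λ 2∣b → 2≢1 (h⊥b (2∣h , 2∣b)))))

ε : ℕ → ℤ
ε b = + 1 - + 2 ℤ.* 𝟙 (2 ∣? b)

Φ± : ℕ → ℕ → ℤ
Φ± h x = ∑ x (λ b → ε b ℤ.* 𝟙⊥ h b)

Φ-2* : ∀ h x → + 2 ℤ.* Φ (2 * h) x ≡ Φ± h x + Φ h x
Φ-2* h x = begin
  + 2 ℤ.* Φ (2 * h) x                           ≡⟨ ∑-*ˡ x (+ 2) (𝟙⊥ (2 * h)) ⟨
  ∑ x (λ b → + 2 ℤ.* 𝟙⊥ (2 * h) b)              ≡⟨ ∑-cong x (λ b _ _ → pointwise b) ⟩
  ∑ x (λ b → ε b ℤ.* 𝟙⊥ h b + 𝟙⊥ h b)           ≡⟨ ∑-distrib-+ x ⟩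
  Φ± h x + Φ h x                                ∎
  where
  open ≡-Reasoning
  pointwise : ∀ b → + 2 ℤ.* 𝟙⊥ (2 * h) b ≡ ε b ℤ.* 𝟙⊥ h b + 𝟙⊥ h b
  pointwise b = begin
    + 2 ℤ.* 𝟙⊥ (2 * h) b                              ≡⟨ cong (+ 2 ℤ.*_) (𝟙-⇔ (coprime? (2 * h) b) (coprime? h b ×-dec ¬? (2 ∣? b))
                                                            coprime-2*⁻ (λ (h⊥b , 2∤b) → coprime-2*⁺ h⊥b 2∤b)) ⟩
    + 2 ℤ.* 𝟙 (coprime? h b ×-dec ¬? (2 ∣? b))       ≡⟨ cong (+ 2 ℤ.*_) (trans (𝟙-× (coprime? h b) (¬? (2 ∣? b)))
                                                                            (cong (𝟙⊥ h b ℤ.*_) (𝟙-¬ (2 ∣? b)))) ⟩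
    + 2 ℤ.* (𝟙⊥ h b ℤ.* (+ 1 - 𝟙 (2 ∣? b)))          ≡⟨ identity (𝟙⊥ h b) (𝟙 (2 ∣? b)) ⟩
    ε b ℤ.* 𝟙⊥ h b + 𝟙⊥ h b                          ∎
    where
    identity : ∀ c e → + 2 ℤ.* (c ℤ.* (+ 1 - e)) ≡ (+ 1 - + 2 ℤ.* e) ℤ.* c + c
    identity = solve-∀

ε-+odd : ∀ {h} b → ¬ 2 ∣ h → ε (h ℕ.+ b) ≡ - ε b
ε-+odd {h} b 2∤h = trans (cong (λ e → + 1 - + 2 ℤ.* e) (𝟙-2∣-+odd b 2∤h)) (flip (𝟙 (2 ∣? b)))
  where
  flip : ∀ e → + 1 - + 2 ℤ.* (+ 1 - e) ≡ - (+ 1 - + 2 ℤ.* e)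
  flip = solve-∀

Φ±[h,2h-1]≡δ₁ : ∀ a → ¬ 2 ∣ suc a → Φ± (suc a) (a ℕ.+ suc a) ≡ δ₁ (suc a)
Φ±[h,2h-1]≡δ₁ a 2∤h = begin
  Φ± h (a ℕ.+ h)                         ≡⟨ insert-cancelling (Φ± h (a ℕ.+ h)) (δ₁ h) ⟩
  Φ± h (a ℕ.+ h) + - + 1 ℤ.* δ₁ h + δ₁ h ≡⟨ cong (λ y → Φ± h (a ℕ.+ h) + y + δ₁ h) last-term ⟨
  ∑ (h ℕ.+ h) g + δ₁ h                   ≡⟨ cong (_+ δ₁ h) (∑-antiperiodic {h} g g-antiperiodic) ⟩
  + 0 + δ₁ h                             ≡⟨ ℤₚ.+-identityˡ (δ₁ h) ⟩
  δ₁ h                                   ∎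
  where
  open ≡-Reasoning
  h = suc a
  g : ℕ → ℤ
  g b = ε b ℤ.* 𝟙⊥ h b
  g-antiperiodic : ∀ b → g (h ℕ.+ b) ≡ - g b
  g-antiperiodic b = trans (cong₂ ℤ._*_ (ε-+odd b 2∤h) (𝟙⊥-periodic h b))
                           (sym (ℤₚ.neg-distribˡ-* (ε b) (𝟙⊥ h b)))
  2∣h+h : 2 ∣ h ℕ.+ h
  2∣h+h = subst (2 ∣_) (cong (h ℕ.+_) (ℕₚ.+-identityʳ h)) (m∣m*n h)
  last-term : g (h ℕ.+ h) ≡ - + 1 ℤ.* δ₁ h
  last-term = cong₂ ℤ._*_ (cong (λ e → + 1 - + 2 ℤ.* e) (𝟙-yes (2 ∣? h ℕ.+ h) 2∣h+h))
    (trans (𝟙⊥-periodic h h) (𝟙-⇔ (coprime? h h) (h ℕ.≟ 1)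
                                   (λ h⊥h → h⊥h (∣-refl , ∣-refl)) (λ { refl → Coprime.1-coprimeTo 1 })))
  insert-cancelling : ∀ s d → s ≡ s + - + 1 ℤ.* d + d
  insert-cancelling = solve-∀

prime>1 : ∀ {p} → Prime p → 1 < p
prime>1 {p} p-prime = ℕ.nonTrivial⇒n>1 p {{prime⇒nonTrivial p-prime}}

∃-prime-divisor : ∀ m → 1 < m → ∃[ p ] Prime p × p ∣ m
∃-prime-divisor = <-rec (λ m → 1 < m → ∃[ p ] Prime p × p ∣ m) step
  where
  step : ∀ m → (∀ {k} → k < m → 1 < k → ∃[ p ] Prime p × p ∣ k) → 1 < m → ∃[ p ] Prime p × p ∣ m
  step m rec 1<m with prime? m
  ... | yes m-prime = m , m-prime , ∣-refl
  ... | no ¬prime with ¬prime⇒composite {{ℕ.n>1⇒nonTrivial 1<m}} ¬prime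
  ...   | hasNonTrivialDivisor {d} d<m d∣m with rec d<m (ℕ.nonTrivial⇒n>1 d)
  ...     | p , p-prime , p∣d = p , p-prime , ∣-trans p∣d d∣m

prime-∣-prime : ∀ {p r} → Prime p → Prime r → r ∣ p → r ≡ p
prime-∣-prime p-prime r-prime r∣p with prime⇒irreducible p-prime r∣p
... | inj₁ refl = ⊥-elim (ℕₚ.<-irrefl refl (prime>1 r-prime))
... | inj₂ r≡p = r≡p

prime∤⇒coprime : ∀ {p d} → Prime p → ¬ p ∣ d → Coprime d p
prime∤⇒coprime p-prime p∤d (i∣d , i∣p) with prime⇒irreducible p-prime i∣p
... | inj₁ i≡1 = i≡1
... | inj₂ refl = ⊥-elim (p∤d i∣d)

ω : ℕ → ℕ
ω m = length (filter (λ p → prime? p ×-dec p ∣? m) (oneTo m))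

−1^_ : ℕ → ℤ
−1^ c = if does (c % 2 ℕ.≟ 0) then + 1 else - + 1

−1^-suc : ∀ c → −1^ suc c ≡ - −1^ c
−1^-suc zero = refl
−1^-suc (suc zero) = refl
−1^-suc (suc (suc c)) = begin
  −1^ (3 ℕ.+ c)      ≡⟨ cong (λ r → −1^ suc r) (ℕₚ.+-comm 2 c) ⟩
  −1^ (suc c ℕ.+ 2)  ≡⟨ cong (λ r → if does (r ℕ.≟ 0) then + 1 else - + 1) ([m+n]%n≡m%n (suc c) 2) ⟩
  −1^ suc c          ≡⟨ −1^-suc c ⟩
  - −1^ c            ≡⟨ cong (λ r → - (if does (r ℕ.≟ 0) then + 1 else - + 1)) ([m+n]%n≡m%n c 2) ⟨
  - −1^ (c ℕ.+ 2)    ≡⟨ cong (λ r → - −1^ r) (ℕₚ.+-comm c 2) ⟩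
  - −1^ (2 ℕ.+ c)    ∎
  where open ≡-Reasoning

HasSquareFactor : ℕ → Set
HasSquareFactor m = ∃[ k ] 2 ≤ k × k * k ∣ m

hasSquareFactor? : ∀ m → .{{ℕ.NonZero m}} → Dec (HasSquareFactor m)
hasSquareFactor? m = map′ fromAny toAny (any? (λ k → (2 ≤? k) ×-dec ((k * k) ∣? m)) (oneTo m))
  where
  fromAny : Any (λ k → 2 ≤ k × k * k ∣ m) (oneTo m) → HasSquareFactor m
  fromAny any with find any
  ... | k , _ , sq = k , sq
  toAny : HasSquareFactor m → Any (λ k → 2 ≤ k × k * k ∣ m) (oneTo m)
  toAny (k@(suc i) , 2≤k , k²∣m) =
    lose (∈-applyUpTo⁺ suc (ℕₚ.≤-trans (ℕₚ.m≤m*n k k) (∣⇒≤ k²∣m))) (2≤k , k²∣m)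

μ-unfold : ∀ m → μ (suc m) ≡ (if does (hasSquareFactor? (suc m)) then + 0 else −1^ ω (suc m))
μ-unfold m = refl

μ-squareful : ∀ {m} → HasSquareFactor m → μ m ≡ + 0
μ-squareful {zero} _ = refl
μ-squareful {suc m} sq = trans (μ-unfold m) (decide (hasSquareFactor? (suc m)))
  where
  decide : (sq? : Dec (HasSquareFactor (suc m))) → (if does sq? then + 0 else −1^ ω (suc m)) ≡ + 0
  decide (yes _) = refl
  decide (no ¬sq) = ⊥-elim (¬sq sq)

μ-squarefree : ∀ {m} .{{_ : ℕ.NonZero m}} → ¬ HasSquareFactor m → μ m ≡ −1^ ω m
μ-squarefree {suc m} ¬sq = trans (μ-unfold m) (decide (hasSquareFactor? (suc m)))
  where
  decide : (sq? : Dec (HasSquareFactor (suc m))) → (if does sq? then + 0 else −1^ ω (suc m)) ≡ −1^ ω (suc m)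
  decide (yes sq) = ⊥-elim (¬sq sq)
  decide (no _) = refl

squareful-* : ∀ {e} p → HasSquareFactor e → HasSquareFactor (e * p)
squareful-* p (k , 2≤k , k²∣e) = k , 2≤k , ∣m⇒∣m*n p k²∣e

squarefree-*-prime : ∀ {e p} → Prime p → ¬ p ∣ e → ¬ HasSquareFactor e → ¬ HasSquareFactor (e * p)
squarefree-*-prime {e} {p} p-prime p∤e ¬sq (k , 2≤k , k²∣ep) with ∃-prime-divisor k 2≤k
... | r , r-prime , r∣k with r ℕ.≟ p
...   | yes refl = p∤e (*-cancelʳ-∣ p {{prime⇒nonZero p-prime}} r²∣ep)
  where
  r²∣ep : r * r ∣ e * r
  r²∣ep = ∣-trans (*-pres-∣ r∣k r∣k) k²∣ep
...   | no r≢p = ¬sq (r , prime>1 r-prime , coprime-divisor r²⊥p (subst (r * r ∣_) (ℕₚ.*-comm e p) r²∣ep))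
  where
  r²∣ep : r * r ∣ e * p
  r²∣ep = ∣-trans (*-pres-∣ r∣k r∣k) k²∣ep
  r⊥p : Coprime r p
  r⊥p = prime∤⇒coprime p-prime (λ p∣r → r≢p (sym (prime-∣-prime r-prime p-prime p∣r)))
  r²⊥p : Coprime (r * r) p
  r²⊥p = coprime-*ˡ r⊥p r⊥p

ω-*-prime : ∀ {e p} → Prime p → ¬ p ∣ e → ω (e * p) ≡ suc (ω e)
ω-*-prime {zero} {p} _ p∤0 = ⊥-elim (p∤0 (p ∣0))
ω-*-prime {e@(suc _)} {p} p-prime p∤e = ℤₚ.+-injective (begin
  + ω (e * p)                                    ≡⟨ length-filter-oneTo (λ x → prime? x ×-dec x ∣? e * p) (e * p) ⟩
  ∑ (e * p) (λ x → 𝟙 (prime? x ×-dec x ∣? e * p)) ≡⟨ ∑-cong (e * p) (λ x _ _ → split x) ⟩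
  ∑ (e * p) (λ x → A x + 𝟙 (x ℕ.≟ p))           ≡⟨ ∑-distrib-+ (e * p) ⟩
  ∑ (e * p) A + ∑ (e * p) (λ x → 𝟙 (x ℕ.≟ p))   ≡⟨ cong₂ _+_ (∑-extend A e≤ep beyond-e) (∑-𝟙-≟ (e * p) p 1≤p) ⟩
  ∑ e A + 𝟙 (p ≤? e * p)                         ≡⟨ cong₂ _+_ (length-filter-oneTo (λ x → prime? x ×-dec x ∣? e) e)
                                                              (sym (𝟙-yes (p ≤? e * p) (ℕₚ.m≤n*m p e))) ⟨
  + ω e + + 1                                    ≡⟨ ℤₚ.pos-+ (ω e) 1 ⟨
  + (ω e ℕ.+ 1)                                  ≡⟨ cong +_ (ℕₚ.+-comm (ω e) 1) ⟩
  + suc (ω e)                                    ∎)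
  where
  open ≡-Reasoning
  instance _ = prime⇒nonZero p-prime
  A : ℕ → ℤ
  A x = 𝟙 (prime? x ×-dec x ∣? e)
  1≤p : 1 ≤ p
  1≤p = ℕₚ.<⇒≤ (prime>1 p-prime)
  e≤ep : e ≤ e * p
  e≤ep = ℕₚ.m≤m*n e p
  beyond-e : ∀ x → e < x → x ≤ e * p → A x ≡ + 0
  beyond-e x e<x _ = 𝟙-no (prime? x ×-dec x ∣? e) (λ (_ , x∣e) → ℕₚ.<⇒≱ e<x (∣⇒≤ x∣e))
  split : ∀ x → 𝟙 (prime? x ×-dec x ∣? e * p) ≡ A x + 𝟙 (x ℕ.≟ p)
  split x = 𝟙-⊎ (prime? x ×-dec x ∣? e * p) (prime? x ×-dec x ∣? e) (x ℕ.≟ p)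
    (λ (x-prime , x∣ep) → classify x-prime (euclidsLemma e p x-prime x∣ep))
    (λ (x-prime , x∣e) → x-prime , ∣m⇒∣m*n p x∣e)
    (λ { refl → p-prime , n∣m*n e })
    (λ { (_ , x∣e) refl → p∤e x∣e })
    where
    classify : Prime x → x ∣ e ⊎ x ∣ p → (Prime x × x ∣ e) ⊎ x ≡ p
    classify x-prime (inj₁ x∣e) = inj₁ (x-prime , x∣e)
    classify x-prime (inj₂ x∣p) = inj₂ (prime-∣-prime p-prime x-prime x∣p)

μ-*-prime-∣ : ∀ {e p} → Prime p → p ∣ e → μ (e * p) ≡ + 0
μ-*-prime-∣ {p = p} p-prime p∣e = μ-squareful (p , prime>1 p-prime , *-monoˡ-∣ p p∣e)

μ-*-prime-∤ : ∀ {e p} → Prime p → ¬ p ∣ e → μ (e * p) ≡ - μ e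
μ-*-prime-∤ {zero} {p} _ p∤0 = ⊥-elim (p∤0 (p ∣0))
μ-*-prime-∤ {e@(suc _)} {p} p-prime p∤e with hasSquareFactor? e
... | yes sq = trans (μ-squareful (squareful-* p sq)) (cong -_ (sym (μ-squareful sq)))
... | no ¬sq = begin
  μ (e * p)          ≡⟨ μ-squarefree (squarefree-*-prime p-prime p∤e ¬sq) ⟩
  −1^ ω (e * p)      ≡⟨ cong −1^_ (ω-*-prime p-prime p∤e) ⟩
  −1^ suc (ω e)      ≡⟨ −1^-suc (ω e) ⟩
  - −1^ ω e          ≡⟨ cong -_ (μ-squarefree ¬sq) ⟨
  - μ e              ∎
  where
  open ≡-Reasoning
  instance _ = ℕₚ.m*n≢0 e p {{_}} {{prime⇒nonZero p-prime}}

∑∣ : ℕ → (ℕ → ℤ) → ℤ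
∑∣ g F = ∑ g (λ d → 𝟙 (d ∣? g) ℤ.* F d)

∑∣-extend : ∀ {g N} .{{_ : ℕ.NonZero g}} (F : ℕ → ℤ) → g ≤ N →
            ∑ N (λ d → 𝟙 (d ∣? g) ℤ.* F d) ≡ ∑∣ g F
∑∣-extend {g} F g≤N = ∑-extend _ g≤N (λ d g<d _ →
  cong (ℤ._* F d) (𝟙-no (d ∣? g) (λ d∣g → ℕₚ.<⇒≱ g<d (∣⇒≤ d∣g))))

∑∣-μ-multiples : ∀ {p} q → Prime p →
  ∑ (q * p) (λ d → 𝟙 (p ∣? d) ℤ.* (𝟙 (d ∣? q * p) ℤ.* μ d)) ≡ - ∑∣ q (λ e → 𝟙 (¬? (p ∣? e)) ℤ.* μ e)
∑∣-μ-multiples {p} q p-prime = begin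
  ∑ (q * p) (λ d → 𝟙 (p ∣? d) ℤ.* T d)             ≡⟨ ∑-multiples q T (ℕₚ.<⇒≤ (prime>1 p-prime)) ⟩
  ∑ q (λ e → T (e * p))                            ≡⟨ ∑-cong q (λ e _ _ → T-at-multiple e) ⟩
  ∑ q (λ e → - (𝟙 (e ∣? q) ℤ.* F e))               ≡⟨ ∑-neg q (λ e → 𝟙 (e ∣? q) ℤ.* F e) ⟩
  - ∑∣ q F                                         ∎
  where
  open ≡-Reasoning
  instance _ = prime⇒nonZero p-prime
  T F : ℕ → ℤ
  T d = 𝟙 (d ∣? q * p) ℤ.* μ d
  F e = 𝟙 (¬? (p ∣? e)) ℤ.* μ e
  T-at-multiple : ∀ e → T (e * p) ≡ - (𝟙 (e ∣? q) ℤ.* F e)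
  T-at-multiple e with p ∣? e
  ... | yes p∣e = trans (cong (𝟙 (e * p ∣? q * p) ℤ.*_) (μ-*-prime-∣ p-prime p∣e))
                        (trans (ℤₚ.*-zeroʳ (𝟙 (e * p ∣? q * p))) (sym (cong -_ (ℤₚ.*-zeroʳ (𝟙 (e ∣? q))))))
  ... | no p∤e = trans (cong₂ ℤ._*_ ep∣qp⇔e∣q (μ-*-prime-∤ p-prime p∤e)) (move-sign (𝟙 (e ∣? q)) (μ e))
    where
    ep∣qp⇔e∣q : 𝟙 (e * p ∣? q * p) ≡ 𝟙 (e ∣? q)
    ep∣qp⇔e∣q = 𝟙-⇔ (e * p ∣? q * p) (e ∣? q) (*-cancelʳ-∣ p) (*-monoˡ-∣ p)
    move-sign : ∀ a m → a ℤ.* - m ≡ - (a ℤ.* (+ 1 ℤ.* m))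
    move-sign = solve-∀

∑∣-μ-non-multiples : ∀ {p} q .{{_ : ℕ.NonZero q}} → Prime p →
  ∑ (q * p) (λ d → 𝟙 (¬? (p ∣? d)) ℤ.* (𝟙 (d ∣? q * p) ℤ.* μ d)) ≡ ∑∣ q (λ e → 𝟙 (¬? (p ∣? e)) ℤ.* μ e)
∑∣-μ-non-multiples {p} q p-prime =
  trans (∑-cong (q * p) (λ d _ _ → pointwise d)) (∑∣-extend F (ℕₚ.m≤m*n q p {{prime⇒nonZero p-prime}}))
  where
  F : ℕ → ℤ
  F e = 𝟙 (¬? (p ∣? e)) ℤ.* μ e
  pointwise : ∀ d → 𝟙 (¬? (p ∣? d)) ℤ.* (𝟙 (d ∣? q * p) ℤ.* μ d) ≡ 𝟙 (d ∣? q) ℤ.* F d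
  pointwise d with p ∣? d
  ... | yes _ = sym (ℤₚ.*-zeroʳ (𝟙 (d ∣? q)))
  ... | no p∤d = trans (cong (λ x → + 1 ℤ.* (x ℤ.* μ d)) d∣qp⇔d∣q) (reorder (𝟙 (d ∣? q)) (μ d))
    where
    d∣qp⇔d∣q : 𝟙 (d ∣? q * p) ≡ 𝟙 (d ∣? q)
    d∣qp⇔d∣q = 𝟙-⇔ (d ∣? q * p) (d ∣? q)
      (λ d∣qp → coprime-divisor (prime∤⇒coprime p-prime p∤d) (subst (d ∣_) (ℕₚ.*-comm q p) d∣qp))
      (∣m⇒∣m*n p)
    reorder : ∀ a m → + 1 ℤ.* (a ℤ.* m) ≡ a ℤ.* (+ 1 ℤ.* m)
    reorder = solve-∀

-- Group the divisors of g = q p (p prime) by divisibility by p: the two groups cancel,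
-- since μ (e p) = - μ e when p ∤ e and μ (e p) = 0 otherwise.
∑∣-μ : ∀ g .{{_ : ℕ.NonZero g}} → ∑∣ g μ ≡ 𝟙 (g ℕ.≟ 1)
∑∣-μ 1 = refl
∑∣-μ g@(suc (suc _)) with ∃-prime-divisor g (s≤s (s≤s z≤n))
... | p , p-prime , divides q g≡qp = begin
  ∑∣ g μ                                                 ≡⟨ cong (λ m → ∑∣ m μ) g≡qp ⟩
  ∑ (q * p) T                                            ≡⟨ ∑-cong (q * p) (λ d _ _ → 𝟙-split (p ∣? d) (T d)) ⟩
  ∑ (q * p) (λ d → 𝟙 (p ∣? d) ℤ.* T d + 𝟙 (¬? (p ∣? d)) ℤ.* T d)
                                                         ≡⟨ ∑-distrib-+ (q * p) ⟩
  ∑ (q * p) (λ d → 𝟙 (p ∣? d) ℤ.* T d) + ∑ (q * p) (λ d → 𝟙 (¬? (p ∣? d)) ℤ.* T d)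
                                                         ≡⟨ cong₂ _+_ (∑∣-μ-multiples q p-prime) (∑∣-μ-non-multiples q p-prime) ⟩
  - ∑∣ q F + ∑∣ q F                                      ≡⟨ ℤₚ.+-inverseˡ (∑∣ q F) ⟩
  + 0                                                    ∎
  where
  open ≡-Reasoning
  T F : ℕ → ℤ
  T d = 𝟙 (d ∣? q * p) ℤ.* μ d
  F e = 𝟙 (¬? (p ∣? e)) ℤ.* μ e
  instance
    q≢0 : ℕ.NonZero q
    q≢0 = ℕ.≢-nonZero (λ { refl → ℕₚ.1+n≢0 g≡qp })

∑∣-𝟙∣-μ : ∀ h m .{{_ : ℕ.NonZero h}} → ∑∣ h (λ d → 𝟙 (d ∣? m) ℤ.* μ d) ≡ 𝟙⊥ h m
∑∣-𝟙∣-μ h m = begin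
  ∑∣ h (λ d → 𝟙 (d ∣? m) ℤ.* μ d)     ≡⟨ ∑-cong h (λ d _ _ → common-divisor d) ⟩
  ∑ h (λ d → 𝟙 (d ∣? g) ℤ.* μ d)      ≡⟨ ∑∣-extend μ (∣⇒≤ (gcd[m,n]∣m h m)) ⟩
  ∑∣ g μ                              ≡⟨ ∑∣-μ g ⟩
  𝟙 (g ℕ.≟ 1)                         ≡⟨ 𝟙-⇔ (g ℕ.≟ 1) (coprime? h m) gcd≡1⇒coprime coprime⇒gcd≡1 ⟩
  𝟙⊥ h m                              ∎
  where
  open ≡-Reasoning
  g = gcd h m
  instance
    g≢0 : ℕ.NonZero g
    g≢0 = ℕ.≢-nonZero (gcd[m,n]≢0 h m (inj₁ (ℕ.≢-nonZero⁻¹ h)))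
  common-divisor : ∀ d → 𝟙 (d ∣? h) ℤ.* (𝟙 (d ∣? m) ℤ.* μ d) ≡ 𝟙 (d ∣? g) ℤ.* μ d
  common-divisor d = begin
    𝟙 (d ∣? h) ℤ.* (𝟙 (d ∣? m) ℤ.* μ d)   ≡⟨ ℤₚ.*-assoc (𝟙 (d ∣? h)) _ _ ⟨
    𝟙 (d ∣? h) ℤ.* 𝟙 (d ∣? m) ℤ.* μ d     ≡⟨ cong (ℤ._* μ d) (𝟙-× (d ∣? h) (d ∣? m)) ⟨
    𝟙 (d ∣? h ×-dec d ∣? m) ℤ.* μ d       ≡⟨ cong (ℤ._* μ d) (𝟙-⇔ (d ∣? h ×-dec d ∣? m) (d ∣? g)
                                               (λ (d∣h , d∣m) → gcd-greatest d∣h d∣m)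
                                               (λ d∣g → ∣-trans d∣g (gcd[m,n]∣m h m) , ∣-trans d∣g (gcd[m,n]∣n h m))) ⟩
    𝟙 (d ∣? g) ℤ.* μ d                    ∎

suc-remainder : ∀ n d .{{_ : ℕ.NonZero d}} → suc (n % d) < d ⊎ suc (n % d) ≡ d
suc-remainder n d = ℕₚ.m≤n⇒m<n∨m≡n (m%n<n n d)

suc-division : ∀ n d .{{_ : ℕ.NonZero d}} → suc n ≡ suc (n % d) ℕ.+ (n / d) * d
suc-division n d = cong suc (m≡m%n+[m/n]*n n d)

/-suc-∤ : ∀ n d .{{_ : ℕ.NonZero d}} → ¬ d ∣ suc n → suc n / d ≡ n / d
/-suc-∤ n d d∤ with suc-remainder n d
... | inj₁ r<d = begin
  suc n / d                                       ≡⟨ /-congˡ (suc-division n d) ⟩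
  (suc (n % d) ℕ.+ (n / d) * d) / d                ≡⟨ +-distrib-/-∣ʳ (suc (n % d)) (n∣m*n (n / d)) ⟩
  suc (n % d) / d ℕ.+ (n / d) * d / d              ≡⟨ cong₂ ℕ._+_ (m<n⇒m/n≡0 r<d) (m*n/n≡m (n / d) d) ⟩
  n / d                                           ∎
  where open ≡-Reasoning
... | inj₂ r≡d = ⊥-elim (d∤ (subst (d ∣_) (sym (trans (suc-division n d) (cong (ℕ._+ (n / d) * d) r≡d)))
                                                 (∣m∣n⇒∣m+n ∣-refl (n∣m*n (n / d)))))

/-suc-∣ : ∀ n d .{{_ : ℕ.NonZero d}} → d ∣ suc n → suc n / d ≡ suc (n / d)
/-suc-∣ n d d∣ with suc-remainder n d
... | inj₁ r<d = ⊥-elim (ℕₚ.<⇒≱ r<d (∣⇒≤ (∣m+n∣m⇒∣n d∣qd+r (n∣m*n (n / d)))))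
  where
  d∣qd+r : d ∣ (n / d) * d ℕ.+ suc (n % d)
  d∣qd+r = subst (d ∣_) (trans (suc-division n d) (ℕₚ.+-comm (suc (n % d)) _)) d∣
... | inj₂ r≡d = trans (/-congˡ (trans (suc-division n d) (cong (ℕ._+ (n / d) * d) r≡d))) (m*n/n≡m (suc (n / d)) d)

𝟙-2∣-*odd : ∀ m {d} → ¬ 2 ∣ d → 𝟙 (2 ∣? m * d) ≡ 𝟙 (2 ∣? m)
𝟙-2∣-*odd m {d} 2∤d = 𝟙-⇔ (2 ∣? m * d) (2 ∣? m) only-left (∣m⇒∣m*n d)
  where
  only-left : 2 ∣ m * d → 2 ∣ m
  only-left 2∣md with euclidsLemma m d prime[2] 2∣md
  ... | inj₁ 2∣m = 2∣m
  ... | inj₂ 2∣d = ⊥-elim (2∤d 2∣d)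

%2-suc : ∀ q → + (suc q % 2) ≡ + (q % 2) + ε (suc q)
%2-suc q = begin
  + (suc q % 2)                                 ≡⟨ %2≡1-𝟙∣ (suc q) ⟩
  + 1 - 𝟙 (2 ∣? suc q)                          ≡⟨ cong (λ e → + 1 - e) parity-flip ⟩
  + 1 - (+ 1 - 𝟙 (2 ∣? q))                      ≡⟨ identity (𝟙 (2 ∣? q)) ⟩
  (+ 1 - 𝟙 (2 ∣? q)) + (+ 1 - + 2 ℤ.* (+ 1 - 𝟙 (2 ∣? q)))
                                                ≡⟨ cong₂ (λ x y → x + (+ 1 - + 2 ℤ.* y)) (%2≡1-𝟙∣ q) parity-flip ⟨
  + (q % 2) + ε (suc q)                         ∎
  where
  open ≡-Reasoning
  parity-flip : 𝟙 (2 ∣? suc q) ≡ + 1 - 𝟙 (2 ∣? q)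
  parity-flip = 𝟙-2∣-+odd q (2≢1 ∘ ∣1⇒≡1)
  identity : ∀ e → + 1 - (+ 1 - e) ≡ (+ 1 - e) + (+ 1 - + 2 ℤ.* (+ 1 - e))
  identity = solve-∀

w-suc : ∀ n d .{{_ : ℕ.NonZero d}} → ¬ 2 ∣ d → + w (suc n) d ≡ + w n d + 𝟙 (d ∣? suc n) ℤ.* ε (suc n)
w-suc n d 2∤d with d ∣? suc n
... | yes d∣ = begin
  + (suc n / d % 2)                        ≡⟨ cong (λ x → + (x % 2)) (/-suc-∣ n d d∣) ⟩
  + (suc q % 2)                            ≡⟨ %2-suc q ⟩
  + (q % 2) + ε (suc q)                    ≡⟨ cong (λ e → + (q % 2) + (+ 1 - + 2 ℤ.* e)) (𝟙-2∣-*odd (suc q) 2∤d) ⟨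
  + (q % 2) + ε (suc q * d)                ≡⟨ cong (λ m → + (q % 2) + ε m)
                                                   (trans (cong (ℕ._* d) (sym (/-suc-∣ n d d∣))) (m/n*n≡m d∣)) ⟩
  + (q % 2) + ε (suc n)                    ≡⟨ cong (_+_ (+ (q % 2))) (ℤₚ.*-identityˡ (ε (suc n))) ⟨
  + w n d + + 1 ℤ.* ε (suc n)              ∎
  where
  open ≡-Reasoning
  q = n / d
... | no d∤ = begin
  + (suc n / d % 2)                        ≡⟨ cong (λ x → + (x % 2)) (/-suc-∤ n d d∤) ⟩
  + w n d                                  ≡⟨ ℤₚ.+-identityʳ (+ w n d) ⟨
  + w n d + + 0 ℤ.* ε (suc n)              ∎
  where open ≡-Reasoning

μw : ℕ → ℕ → ℤ
μw n zero = + 0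
μw n d@(suc _) = μ d ℤ.* + w n d

divisorSum-as-∑∣ : ∀ n h → divisorSum n h ≡ ∑∣ h (μw n)
divisorSum-as-∑∣ n h = trans (sumℤ-oneTo h _) (∑-cong h (λ { d@(suc _) _ _ → if-then-0≡𝟙* (d ∣? h) (μw n d) }))

∑∣-μw : ∀ n h .{{_ : ℕ.NonZero h}} → ¬ 2 ∣ h → ∑∣ h (μw n) ≡ Φ± h n
∑∣-μw zero h _ = ∑-zero h (λ { d@(suc _) _ _ →
  trans (cong (𝟙 (d ∣? h) ℤ.*_) (ℤₚ.*-zeroʳ (μ d))) (ℤₚ.*-zeroʳ (𝟙 (d ∣? h))) })
∑∣-μw (suc n) h 2∤h = begin
  ∑∣ h (μw (suc n))                                                  ≡⟨ ∑-cong h (λ d 1≤d _ → step d 1≤d) ⟩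
  ∑ h (λ d → 𝟙 (d ∣? h) ℤ.* μw n d + ε (suc n) ℤ.* (𝟙 (d ∣? h) ℤ.* (𝟙 (d ∣? suc n) ℤ.* μ d)))
                                                                     ≡⟨ ∑-distrib-+ h ⟩
  ∑∣ h (μw n) + ∑ h (λ d → ε (suc n) ℤ.* (𝟙 (d ∣? h) ℤ.* (𝟙 (d ∣? suc n) ℤ.* μ d)))
                                                                     ≡⟨ cong₂ _+_ (∑∣-μw n h 2∤h) (∑-*ˡ h (ε (suc n)) _) ⟩
  Φ± h n + ε (suc n) ℤ.* ∑∣ h (λ d → 𝟙 (d ∣? suc n) ℤ.* μ d)        ≡⟨ cong (λ x → Φ± h n + ε (suc n) ℤ.* x)
                                                                          (∑∣-𝟙∣-μ h (suc n)) ⟩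
  Φ± h (suc n)                                                       ∎
  where
  open ≡-Reasoning
  step : ∀ d → 1 ≤ d → 𝟙 (d ∣? h) ℤ.* μw (suc n) d
                       ≡ 𝟙 (d ∣? h) ℤ.* μw n d + ε (suc n) ℤ.* (𝟙 (d ∣? h) ℤ.* (𝟙 (d ∣? suc n) ℤ.* μ d))
  step d@(suc _) _ with d ∣? h
  ... | yes d∣h = trans (cong (λ x → 𝟙 (d ∣? h) ℤ.* (μ d ℤ.* x)) (w-suc n d (λ 2∣d → 2∤h (∣-trans 2∣d d∣h))))
                        (expand (𝟙 (d ∣? h)) (μ d) (+ w n d) (𝟙 (d ∣? suc n)) (ε (suc n)))
    where
    expand : ∀ a m x i e → a ℤ.* (m ℤ.* (x + i ℤ.* e)) ≡ a ℤ.* (m ℤ.* x) + e ℤ.* (a ℤ.* (i ℤ.* m))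
    expand = solve-∀
  ... | no d∤h = subst (λ a → a ℤ.* μw (suc n) d ≡ a ℤ.* μw n d + ε (suc n) ℤ.* (a ℤ.* (𝟙 (d ∣? suc n) ℤ.* μ d)))
                       (sym (𝟙-no (d ∣? h) d∤h)) (vanish (μw (suc n) d) (μw n d) (ε (suc n)) (𝟙 (d ∣? suc n) ℤ.* μ d))
    where
    vanish : ∀ x y e z → + 0 ℤ.* x ≡ + 0 ℤ.* y + e ℤ.* (+ 0 ℤ.* z)
    vanish = solve-∀

divisorSum-as-Φ± : ∀ n h → ¬ 2 ∣ h → divisorSum n h ≡ Φ± h n
divisorSum-as-Φ± n zero 2∤0 = ⊥-elim (2∤0 (2 ∣0))
divisorSum-as-Φ± n h@(suc _) 2∤h = trans (divisorSum-as-∑∣ n h) (∑∣-μw n h 2∤h)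

𝒩-h-as-Φ : ∀ a n → 2 * suc a ≤ n → + 𝒩 n (suc a) ≡ Φ (suc a) n - Φ (suc a) a
𝒩-h-as-Φ a n 2h≤n = 𝒩-as-Φ n a (ℕₚ.≤-trans (ℕₚ.m≤m+n a (suc a ℕ.+ 0)) (ℕₚ.<⇒≤ 2h≤n))

𝒩-2h-as-Φ : ∀ a n → 2 * suc a ≤ n → + 𝒩 n (2 * suc a) ≡ Φ (2 * suc a) n - Φ (2 * suc a) (a ℕ.+ suc a)
𝒩-2h-as-Φ a n 2h≤n = trans (𝒩-as-Φ n (a ℕ.+ (suc a ℕ.+ 0)) (ℕₚ.<⇒≤ 2h≤n))
  (cong (λ t → Φ (2 * suc a) n - Φ (2 * suc a) (a ℕ.+ t)) (ℕₚ.+-identityʳ (suc a)))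

𝒩-2h-even : ∀ a n → 2 * suc a ≤ n → 2 ∣ suc a → + 𝒩 n (2 * suc a) ≡ + 𝒩 n (suc a) - + φ (suc a)
𝒩-2h-even a n 2h≤n 2∣h = begin
  + 𝒩 n (2 * h)                     ≡⟨ 𝒩-2h-as-Φ a n 2h≤n ⟩
  Φ (2 * h) n - Φ (2 * h) (a ℕ.+ h) ≡⟨ cong₂ _-_ (Φ-2*-even 2∣h n)
                                                 (trans (Φ-2*-even 2∣h (a ℕ.+ h)) (Φ-+-period h a)) ⟩
  Φ h n - (Φ h a + + φ h)           ≡⟨ regroup (Φ h n) (Φ h a) (+ φ h) ⟩
  (Φ h n - Φ h a) - + φ h           ≡⟨ cong (_- + φ h) (𝒩-h-as-Φ a n 2h≤n) ⟨
  + 𝒩 n h - + φ h                   ∎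
  where
  open ≡-Reasoning
  h = suc a
  regroup : ∀ x y f → x - (y + f) ≡ (x - y) - f
  regroup = solve-∀

𝒩-2h-odd : ∀ a n → 2 * suc a ≤ n → ¬ 2 ∣ suc a →
  + 2 ℤ.* + 𝒩 n (2 * suc a) ≡ + 𝒩 n (suc a) - + φ (suc a) - δ₁ (suc a) + divisorSum n (suc a)
𝒩-2h-odd a n 2h≤n 2∤h = begin
  + 2 ℤ.* + 𝒩 n (2 * h)                                 ≡⟨ cong (+ 2 ℤ.*_) (𝒩-2h-as-Φ a n 2h≤n) ⟩
  + 2 ℤ.* (Φ (2 * h) n - Φ (2 * h) (a ℕ.+ h))           ≡⟨ double-difference (Φ (2 * h) n) _ ⟩
  + 2 ℤ.* Φ (2 * h) n - + 2 ℤ.* Φ (2 * h) (a ℕ.+ h)     ≡⟨ cong₂ _-_ (Φ-2* h n) (Φ-2* h (a ℕ.+ h)) ⟩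
  (Φ± h n + Φ h n) - (Φ± h (a ℕ.+ h) + Φ h (a ℕ.+ h))   ≡⟨ cong (λ y → (Φ± h n + Φ h n) - y)
                                                               (cong₂ _+_ (Φ±[h,2h-1]≡δ₁ a 2∤h) (Φ-+-period h a)) ⟩
  (Φ± h n + Φ h n) - (δ₁ h + (Φ h a + + φ h))           ≡⟨ regroup (Φ± h n) (Φ h n) (δ₁ h) (Φ h a) (+ φ h) ⟩
  (Φ h n - Φ h a) - + φ h - δ₁ h + Φ± h n               ≡⟨ cong₂ (λ x y → x - + φ h - δ₁ h + y)
                                                               (𝒩-h-as-Φ a n 2h≤n)
                                                               (divisorSum-as-Φ± n h 2∤h) ⟨
  + 𝒩 n h - + φ h - δ₁ h + divisorSum n h               ∎
  where
  open ≡-Reasoning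
  h = suc a
  double-difference : ∀ x y → + 2 ℤ.* (x - y) ≡ + 2 ℤ.* x - + 2 ℤ.* y
  double-difference = solve-∀
  regroup : ∀ s x d y f → (s + x) - (d + (y + f)) ≡ (x - y) - f - d + s
  regroup = solve-∀

corollary3 : (h n : ℕ) → 0 < h → 2 * h < n →
    ((2 ∣ h) → + 𝒩 n (2 * h) ≡ + 𝒩 n h - + φ h)
    × ((¬ (2 ∣ h)) → + 2 ℤ.* + 𝒩 n (2 * h) ≡ + 𝒩 n h - + φ h - δ₁ h + divisorSum n h)
corollary3 zero n () _
corollary3 (suc a) n _ 2h<n = 𝒩-2h-even a n (ℕₚ.<⇒≤ 2h<n) , 𝒩-2h-odd a n (ℕₚ.<⇒≤ 2h<n)
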